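{- Let $G$ be an optimal graph and let $u$ and $v$ be vertices of $G$. Then $\deg(u) \ge \deg(v) - 1$ or $\deg_{\mathrm{Non}\text{ - }\Delta}(u) \ge \deg_{\mathrm{Non}\text{ - }\Delta}(v) - 1$.
   Context: An edge of a graph is triangular if it lies in a triangle, non-triangular otherwise; $t(G)$ is the number of non-triangular edges of $G$ and $e(G)$ the number of edges. $\deg_{\mathrm{Non}\text{ - }\Delta}(u)$ is the number of non-triangular edges incident with $u$. A graph $G$ on $n$ vertices is optimal if there is no graph $H$ on $n$ vertices such that either ($t(H) > t(G)$ and $e(H) \ge e(G)$) or ($e(H) > e(G)$ and $t(H) \ge t(G)$). -}

module Defs where

open import Data.Nat using (ℕ; zero; suc; _+_; _∸_; _≤_; _<_)
open import Data.Nat using (_<ᵇ_)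
open import Data.Fin using (Fin; toℕ)
import Data.Fin
open import Data.Bool using (Bool; true; false; _∧_; _∨_; not; if_then_else_)
open import Data.Product using (_×_)
open import Data.Sum using (_⊎_)
open import Relation.Nullary using (¬_)
open import Relation.Binary.PropositionalEquality using (_≡_)

count : ∀ {n} → (Fin n → Bool) → ℕ
count {zero}  p = 0
count {suc n} p = (if p Data.Fin.zero then 1 else 0) + count (λ i → p (Data.Fin.suc i))

anyF : ∀ {n} → (Fin n → Bool) → Bool
anyF {zero}  p = false
anyF {suc n} p = p Data.Fin.zero ∨ anyF (λ i → p (Data.Fin.suc i))

record Graph (n : ℕ) : Set where
  field
    adj    : Fin n → Fin n → Bool
    sym    : ∀ i j → adj i j ≡ adj j i
    irrefl : ∀ i → adj i i ≡ false
open Graph public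

deg : ∀ {n} → Graph n → Fin n → ℕ
deg G u = count (adj G u)

triangularB : ∀ {n} → Graph n → Fin n → Fin n → Bool
triangularB G u v = anyF (λ w → adj G u w ∧ adj G v w)

nonTriEdge : ∀ {n} → Graph n → Fin n → Fin n → Bool
nonTriEdge G u v = adj G u v ∧ not (triangularB G u v)

degNonTri : ∀ {n} → Graph n → Fin n → ℕ
degNonTri G u = count (nonTriEdge G u)

sumF : ∀ {n} → (Fin n → ℕ) → ℕ
sumF {zero}  f = 0
sumF {suc n} f = f Data.Fin.zero + sumF (λ i → f (Data.Fin.suc i))

-- number of unordered pairs {i,j} (i < j) satisfying a symmetric predicate
pairCount : ∀ {n} → (Fin n → Fin n → Bool) → ℕ
pairCount p = sumF (λ i → count (λ j → p i j ∧ (toℕ i <ᵇ toℕ j)))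

e : ∀ {n} → Graph n → ℕ
e G = pairCount (adj G)

t : ∀ {n} → Graph n → ℕ
t G = pairCount (nonTriEdge G)

Optimal : ∀ {n} → Graph n → Set
Optimal {n} G = (H : Graph n) →
  ¬ ((t G < t H × e G ≤ e H) ⊎ (e G < e H × t G ≤ t H))

-- Suppose deg(v) ≥ deg(u) + 2 and deg_Non-Δ(v) ≥ deg_Non-Δ(u) + 2. Replace the
-- neighbourhood of u by that of v (minus u itself), i.e. pull G back along the map
-- sending u to v. Edges away from u are untouched, and a triangle in the new graph
-- maps to a triangle of G, so no non-triangular edge away from u is lost; the new
-- vertex u inherits all but at most one of the edges and of the non-triangular
-- edges at v. Hence u gains at least one edge and one non-triangular edge, so e and
-- t both strictly increase, contradicting optimality.
module Submission where

open import Defs hiding (sym)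
open import Data.Nat using (ℕ; zero; suc; _+_; _∸_; _≤_; _<_; _<ᵇ_; z≤n; s≤s; _≤?_)
open import Data.Nat.Properties hiding (_≟_)
open import Data.Fin using (Fin; toℕ; punchIn) renaming (zero to fz; suc to fs)
open import Data.Fin.Properties using (_≟_; toℕ-injective; punchInᵢ≢i)
open import Data.Bool using (Bool; true; false; _∧_; _∨_; not; T)
open import Data.Bool.Properties using (T-∨; ∧-comm)
open import Data.Product using (∃; _,_)
import Data.Product as Product
open import Data.Sum using (_⊎_; inj₁; inj₂)
open import Data.Unit using (tt)
open import Data.Empty using (⊥-elim)
open import Function using (_∘_; id; Equivalence)
open import Relation.Nullary using (¬_; yes; no; contradiction)
open import Relation.Binary.PropositionalEquality
open import Algebra.Properties.CommutativeMonoid.Sum +-0-commutativeMonoid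
  using (sum; sum-cong-≗; sum-remove; ∑-distrib-+; ∑-comm)

𝟙 : Bool → ℕ
𝟙 true  = 1
𝟙 false = 0

𝟙≤1 : ∀ b → 𝟙 b ≤ 1
𝟙≤1 true  = ≤-refl
𝟙≤1 false = z≤n

𝟙-mono : ∀ {a b} → (T a → T b) → 𝟙 a ≤ 𝟙 b
𝟙-mono {false}         _ = z≤n
𝟙-mono {true} {true}  _ = ≤-refl
𝟙-mono {true} {false} h = ⊥-elim (h tt)

sumF≡sum : ∀ {n} (f : Fin n → ℕ) → sumF f ≡ sum f
sumF≡sum {zero}  f = refl
sumF≡sum {suc n} f = cong (f fz +_) (sumF≡sum (f ∘ fs))

sum-mono-≤ : ∀ {n} {f g : Fin n → ℕ} → (∀ i → f i ≤ g i) → sum f ≤ sum g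
sum-mono-≤ {zero}  _   = z≤n
sum-mono-≤ {suc n} f≤g = +-mono-≤ (f≤g fz) (sum-mono-≤ (f≤g ∘ fs))

count≡sum : ∀ {n} (p : Fin n → Bool) → count p ≡ sum (𝟙 ∘ p)
count≡sum {zero}  p = refl
count≡sum {suc n} p with p fz
... | true  = cong suc (count≡sum (p ∘ fs))
... | false = count≡sum (p ∘ fs)

count-cong : ∀ {n} {p q : Fin n → Bool} → (∀ i → p i ≡ q i) → count p ≡ count q
count-cong {p = p} {q} p≗q =
  trans (count≡sum p) (trans (sum-cong-≗ (cong 𝟙 ∘ p≗q)) (sym (count≡sum q)))

count-mono : ∀ {n} {p q : Fin n → Bool} → (∀ i → T (p i) → T (q i)) → count p ≤ count q
count-mono {p = p} {q} p⇒q =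
  subst₂ _≤_ (sym (count≡sum p)) (sym (count≡sum q)) (sum-mono-≤ (𝟙-mono ∘ p⇒q))

count-split : ∀ {n} (p q : Fin n → Bool) →
  count p ≡ count (λ i → p i ∧ q i) + count (λ i → p i ∧ not (q i))
count-split p q = begin
  count p                               ≡⟨ count≡sum p ⟩
  sum (𝟙 ∘ p)                           ≡⟨ sum-cong-≗ (λ i → split (p i) (q i)) ⟩
  sum (λ i → 𝟙 (both i) + 𝟙 (pOnly i))  ≡⟨ ∑-distrib-+ (𝟙 ∘ both) (𝟙 ∘ pOnly) ⟩
  sum (𝟙 ∘ both) + sum (𝟙 ∘ pOnly)      ≡⟨ sym (cong₂ _+_ (count≡sum both) (count≡sum pOnly)) ⟩
  count both + count pOnly              ∎
  where
  open ≡-Reasoning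
  split : ∀ a b → 𝟙 a ≡ 𝟙 (a ∧ b) + 𝟙 (a ∧ not b)
  split true  true  = refl
  split true  false = refl
  split false _     = refl
  both pOnly : Fin _ → Bool
  both  i = p i ∧ q i
  pOnly i = p i ∧ not (q i)

count≤suc-count∘ : ∀ {n} (u : Fin n) {φ : Fin n → Fin n} → (∀ {i} → i ≢ u → φ i ≡ i) →
  (p : Fin n → Bool) → count p ≤ suc (count (p ∘ φ))
count≤suc-count∘ {suc n} u {φ} fix p = begin
  count p                                   ≡⟨ trans (count≡sum p) (sum-remove {i = u} (𝟙 ∘ p)) ⟩
  𝟙 (p u) + sum (𝟙 ∘ p ∘ punchIn u)          ≤⟨ +-mono-≤ (𝟙≤1 (p u)) (≤-reflexive away-from-u) ⟩
  suc (sum (𝟙 ∘ p ∘ φ ∘ punchIn u))           ≤⟨ s≤s (m≤n+m _ (𝟙 (p (φ u)))) ⟩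
  suc (𝟙 (p (φ u)) + sum (𝟙 ∘ p ∘ φ ∘ punchIn u))
    ≡⟨ cong suc (sym (trans (count≡sum (p ∘ φ)) (sum-remove {i = u} (𝟙 ∘ p ∘ φ)))) ⟩
  suc (count (p ∘ φ))                       ∎
  where
  open ≤-Reasoning
  away-from-u : sum (𝟙 ∘ p ∘ punchIn u) ≡ sum (𝟙 ∘ p ∘ φ ∘ punchIn u)
  away-from-u = sum-cong-≗ (λ k → cong (𝟙 ∘ p) (sym (fix (punchInᵢ≢i u k))))

anyF⇒∃ : ∀ {n} (p : Fin n → Bool) → T (anyF p) → ∃ (T ∘ p)
anyF⇒∃ {suc n} p any-p with Equivalence.to T-∨ any-p
... | inj₁ p0   = fz , p0
... | inj₂ rest = Product.map fs id (anyF⇒∃ (p ∘ fs) rest)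

∃⇒anyF : ∀ {n} (p : Fin n → Bool) → ∃ (T ∘ p) → T (anyF p)
∃⇒anyF p (fz   , pw) = Equivalence.from T-∨ (inj₁ pw)
∃⇒anyF p (fs w , pw) = Equivalence.from T-∨ (inj₂ (∃⇒anyF (p ∘ fs) (w , pw)))

anyF-∘ : ∀ {m n} (p : Fin n → Bool) (φ : Fin m → Fin n) → T (anyF (p ∘ φ)) → T (anyF p)
anyF-∘ p φ = ∃⇒anyF p ∘ Product.map φ id ∘ anyF⇒∃ (p ∘ φ)

anyF-cong : ∀ {n} {p q : Fin n → Bool} → (∀ i → p i ≡ q i) → anyF p ≡ anyF q
anyF-cong {zero}  _   = refl
anyF-cong {suc n} p≗q = cong₂ _∨_ (p≗q fz) (anyF-cong (p≗q ∘ fs))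

∧-not-antitone : ∀ {a b c} → (T c → T b) → T (a ∧ not b) → T (a ∧ not c)
∧-not-antitone {true}  {false} {false} _   _ = tt
∧-not-antitone {true}  {false} {true}  c⇒b _ = c⇒b tt
∧-not-antitone {true}  {true}          _   ()
∧-not-antitone {false}                 _   ()

not-<ᵇ : ∀ m n → m ≢ n → not (m <ᵇ n) ≡ (n <ᵇ m)
not-<ᵇ zero    zero    m≢n = contradiction refl m≢n
not-<ᵇ zero    (suc n) _   = refl
not-<ᵇ (suc m) zero    _   = refl
not-<ᵇ (suc m) (suc n) m≢n = not-<ᵇ m n (m≢n ∘ cong suc)

m+m<n+n⇒m<n : ∀ {m n} → m + m < n + n → m < n
m+m<n+n⇒m<n lt = ≰⇒> (λ n≤m → <⇒≱ lt (+-mono-≤ n≤m n≤m))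

∸1-≰⇒< : ∀ {a b c} → ¬ (a ∸ 1 ≤ b) → a ≤ suc c → b < c
∸1-≰⇒< a∸1≰b a≤1+c = <-≤-trans (≰⇒> a∸1≰b) (∸-monoˡ-≤ 1 a≤1+c)

degreeSum≡e+e : ∀ {n} (G : Graph n) → sum (deg G) ≡ e G + e G
degreeSum≡e+e G = begin
  sum (deg G)                  ≡⟨ sum-cong-≗ (λ i → count-split (adj G i) (lt i)) ⟩
  sum (λ i → up i + down i)    ≡⟨ ∑-distrib-+ up down ⟩
  sum up + sum down            ≡⟨ cong₂ _+_ (sym (sumF≡sum up)) down≡e ⟩
  e G + e G                    ∎
  where
  open ≡-Reasoning
  lt : Fin _ → Fin _ → Bool
  lt i j = toℕ i <ᵇ toℕ j
  up down : Fin _ → ℕ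
  up   i = count (λ j → adj G i j ∧ lt i j)
  down i = count (λ j → adj G i j ∧ not (lt i j))
  lower : Fin _ → Fin _ → Bool
  lower i j = adj G j i ∧ lt j i
  reverse : ∀ i j → (adj G i j ∧ not (lt i j)) ≡ lower i j
  reverse i j with i ≟ j
  ... | no i≢j  = cong₂ _∧_ (Graph.sym G i j) (not-<ᵇ (toℕ i) (toℕ j) (i≢j ∘ toℕ-injective))
  ... | yes refl rewrite irrefl G i = refl
  down≡e : sum down ≡ e G
  down≡e = begin
    sum down
      ≡⟨ sum-cong-≗ (λ i → trans (count-cong (reverse i)) (count≡sum (lower i))) ⟩
    sum (λ i → sum (λ j → 𝟙 (lower i j)))
      ≡⟨ ∑-comm (λ i j → 𝟙 (lower i j)) ⟩
    sum (λ j → sum (λ i → 𝟙 (lower i j)))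
      ≡⟨ sum-cong-≗ (λ j → sym (count≡sum (λ i → lower i j))) ⟩
    sum up
      ≡⟨ sym (sumF≡sum up) ⟩
    e G ∎

degreeSumAvoiding : ∀ {n} → Graph (suc n) → Fin (suc n) → ℕ
degreeSumAvoiding G u = sum λ k → sum λ l → 𝟙 (adj G (punchIn u k) (punchIn u l))

deg≡sum-punchIn : ∀ {n} (G : Graph (suc n)) (u : Fin (suc n)) →
  deg G u ≡ sum (λ l → 𝟙 (adj G u (punchIn u l)))
deg≡sum-punchIn G u = begin
  deg G u                         ≡⟨ trans (count≡sum (adj G u)) (sum-remove {i = u} (𝟙 ∘ adj G u)) ⟩
  𝟙 (adj G u u) + sum (𝟙 ∘ row)   ≡⟨ cong (λ b → 𝟙 b + sum (𝟙 ∘ row)) (irrefl G u) ⟩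
  sum (𝟙 ∘ row)                   ∎
  where
  open ≡-Reasoning
  row : Fin _ → Bool
  row l = adj G u (punchIn u l)

degreeSum≡deg+deg+avoiding : ∀ {n} (G : Graph (suc n)) (u : Fin (suc n)) →
  sum (deg G) ≡ deg G u + (deg G u + degreeSumAvoiding G u)
degreeSum≡deg+deg+avoiding G u = begin
  sum (deg G)
    ≡⟨ sum-cong-≗ (λ i → trans (count≡sum (adj G i)) (sum-remove {i = u} (𝟙 ∘ adj G i))) ⟩
  sum (λ i → 𝟙 (adj G i u) + row i)
    ≡⟨ ∑-distrib-+ (λ i → 𝟙 (adj G i u)) row ⟩
  sum (λ i → 𝟙 (adj G i u)) + sum row
    ≡⟨ cong₂ _+_ column≡deg (sum-remove {i = u} row) ⟩
  deg G u + (row u + degreeSumAvoiding G u)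
    ≡⟨ cong (λ d → deg G u + (d + degreeSumAvoiding G u)) (sym (deg≡sum-punchIn G u)) ⟩
  deg G u + (deg G u + degreeSumAvoiding G u) ∎
  where
  open ≡-Reasoning
  row : Fin _ → ℕ
  row i = sum (λ l → 𝟙 (adj G i (punchIn u l)))
  column≡deg : sum (λ i → 𝟙 (adj G i u)) ≡ deg G u
  column≡deg = trans (sum-cong-≗ (λ i → cong 𝟙 (Graph.sym G i u))) (sym (count≡sum (adj G u)))

e-< : ∀ {n} (A B : Graph n) (u : Fin n) →
  (∀ i j → i ≢ u → j ≢ u → T (adj A i j) → T (adj B i j)) →
  deg A u < deg B u → e A < e B
e-< {suc n} A B u A⊆B deg< = m+m<n+n⇒m<n (begin-strict
  e A + e A                                     ≡⟨ sym (degreeSum≡e+e A) ⟩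
  sum (deg A)                                   ≡⟨ degreeSum≡deg+deg+avoiding A u ⟩
  deg A u + (deg A u + degreeSumAvoiding A u)   <⟨ +-mono-<-≤ deg< (+-mono-≤ (<⇒≤ deg<) avoiding≤) ⟩
  deg B u + (deg B u + degreeSumAvoiding B u)   ≡⟨ sym (degreeSum≡deg+deg+avoiding B u) ⟩
  sum (deg B)                                   ≡⟨ degreeSum≡e+e B ⟩
  e B + e B                                     ∎)
  where
  open ≤-Reasoning
  avoiding≤ : degreeSumAvoiding A u ≤ degreeSumAvoiding B u
  avoiding≤ = sum-mono-≤ λ k → sum-mono-≤ λ l →
    𝟙-mono (A⊆B _ _ (punchInᵢ≢i u k) (punchInᵢ≢i u l))

pullback : ∀ {m n} → (Fin m → Fin n) → Graph n → Graph m
pullback φ G = record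
  { adj    = λ i j → adj G (φ i) (φ j)
  ; sym    = λ i j → Graph.sym G (φ i) (φ j)
  ; irrefl = λ i → irrefl G (φ i)
  }

nonTriangularGraph : ∀ {n} → Graph n → Graph n
nonTriangularGraph G = record
  { adj    = nonTriEdge G
  ; sym    = λ i j → cong₂ _∧_ (Graph.sym G i j)
                       (cong not (anyF-cong (λ w → ∧-comm (adj G i w) (adj G j w))))
  ; irrefl = λ i → cong (_∧ not (triangularB G i i)) (irrefl G i)
  }

triangular-pullback : ∀ {m n} (φ : Fin m → Fin n) (G : Graph n) i j →
  T (triangularB (pullback φ G) i j) → T (triangularB G (φ i) (φ j))
triangular-pullback φ G i j = anyF-∘ (λ w → adj G (φ i) w ∧ adj G (φ j) w) φ

nonTriEdge-pullback : ∀ {m n} (φ : Fin m → Fin n) (G : Graph n) i j →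
  T (nonTriEdge G (φ i) (φ j)) → T (nonTriEdge (pullback φ G) i j)
nonTriEdge-pullback φ G i j = ∧-not-antitone (triangular-pullback φ G i j)

redirect : ∀ {n} → Fin n → Fin n → Fin n → Fin n
redirect u v i with i ≟ u
... | yes _ = v
... | no  _ = i

redirect-self : ∀ {n} (u v : Fin n) → redirect u v u ≡ v
redirect-self u v with u ≟ u
... | yes _   = refl
... | no  u≢u = contradiction refl u≢u

redirect-≢ : ∀ {n} {u i : Fin n} (v : Fin n) → i ≢ u → redirect u v i ≡ i
redirect-≢ {u = u} {i} v i≢u with i ≟ u
... | yes i≡u = contradiction i≡u i≢u
... | no  _   = refl

e-<-redirect : ∀ {n} (A B : Graph n) (u v : Fin n) →
  (∀ i j → T (adj A (redirect u v i) (redirect u v j)) → T (adj B i j)) →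
  ¬ (deg A v ∸ 1 ≤ deg A u) → e A < e B
e-<-redirect A B u v pullback⊆B deg-gap = e-< A B u A⊆B-off-u (∸1-≰⇒< deg-gap deg-v≤1+deg-u)
  where
  A⊆B-off-u : ∀ i j → i ≢ u → j ≢ u → T (adj A i j) → T (adj B i j)
  A⊆B-off-u i j i≢u j≢u =
    pullback⊆B i j ∘ subst T (sym (cong₂ (adj A) (redirect-≢ v i≢u) (redirect-≢ v j≢u)))
  deg-v≤1+deg-u : deg A v ≤ suc (deg B u)
  deg-v≤1+deg-u = ≤-trans (count≤suc-count∘ u (redirect-≢ v) (adj A v)) (s≤s (count-mono at-u))
    where
    at-u : ∀ j → T (adj A v (redirect u v j)) → T (adj B u j)
    at-u j = pullback⊆B u j ∘ subst (λ w → T (adj A w (redirect u v j))) (sym (redirect-self u v))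

mainTheorem5 : (n : ℕ) (G : Graph n) → Optimal G → (u v : Fin n) →
    (deg G v ∸ 1 ≤ deg G u) ⊎ (degNonTri G v ∸ 1 ≤ degNonTri G u)
mainTheorem5 n G optimal u v with deg G v ∸ 1 ≤? deg G u | degNonTri G v ∸ 1 ≤? degNonTri G u
... | yes deg-ok | _         = inj₁ deg-ok
... | no _       | yes nt-ok = inj₂ nt-ok
... | no deg-gap | no nt-gap = ⊥-elim (optimal H (inj₁ (t< , <⇒≤ e<)))
  where
  H : Graph n
  H = pullback (redirect u v) G
  e< : e G < e H
  e< = e-<-redirect G H u v (λ _ _ → id) deg-gap
  -- t and degNonTri are, definitionally, e and deg of nonTriangularGraph.
  t< : t G < t H
  t< = e-<-redirect (nonTriangularGraph G) (nonTriangularGraph H) u v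
         (nonTriEdge-pullback (redirect u v) G) nt-gap
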